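{- For each integer $k\ge0$, \[ N_2^kN_3=\begin{pmatrix}4c_k-d_k&\sqrt3(3c_k-d_k)\\\sqrt3c_k&d_k\end{pmatrix},\qquad N_3N_4^k=\begin{pmatrix}d_k&\sqrt3(3c_k-d_k)\\\sqrt3c_k&4c_k-d_k\end{pmatrix}, \] where, with $\lambda=\frac{3+\sqrt{13}}2$ and $\overline\lambda=\frac{3-\sqrt{13}}2$, \[ c_k=\frac1{\sqrt{13}}\left(\lambda^{k+1}-\overline\lambda^{k+1}\right),\qquad d_k=\frac1{\sqrt{13}}\left[\frac{7-\sqrt{13}}2\lambda^{k+1}-\frac{7+\sqrt{13}}2\overline\lambda^{k+1}\right]. \] Further, $9c_k^2-7c_kd_k+d_k^2=(-1)^{k+1}$.
   Context: $N_2=\begin{pmatrix}2&\sqrt3\\\sqrt3&1\end{pmatrix}$, $N_3=\begin{pmatrix}2&\sqrt3\\\sqrt3&2\end{pmatrix}$, $N_4=\begin{pmatrix}1&\sqrt3\\\sqrt3&2\end{pmatrix}$. -}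

module Defs where

open import Data.Nat using (ℕ; zero; suc)
open import Data.Integer using (ℤ; +_; -[1+_])
open import Data.Rational using (ℚ; _/_; 0ℚ; 1ℚ)
import Data.Rational as Q
open import Data.Product using (_×_)
open import Relation.Binary.PropositionalEquality using (_≡_)

-- The biquadratic field K = ℚ(√3, √13) ⊂ ℝ, with ℚ-basis 1, √3, √13, √39.
-- ⟨ a , b , c , d ⟩ represents a + b√3 + c√13 + d√39.
-- (ℚ from the stdlib is normalised, so _≡_ on K is equality of real numbers.)
record K : Set where
  constructor ⟨_,_,_,_⟩
  field
    r   : ℚ
    s3  : ℚ
    s13 : ℚ
    s39 : ℚ
open K public

infixl 6 _+K_ _-K_
infixl 7 _*K_

_+K_ : K → K → K
⟨ a , b , c , d ⟩ +K ⟨ a' , b' , c' , d' ⟩ =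
  ⟨ a Q.+ a' , b Q.+ b' , c Q.+ c' , d Q.+ d' ⟩

-K_ : K → K
-K ⟨ a , b , c , d ⟩ = ⟨ Q.- a , Q.- b , Q.- c , Q.- d ⟩

_-K_ : K → K → K
x -K y = x +K (-K y)

-- multiplication using √3²=3, √13²=13, √39²=39, √3√13=√39, √3√39=3√13, √13√39=13√3
_*K_ : K → K → K
⟨ a , b , c , d ⟩ *K ⟨ a' , b' , c' , d' ⟩ =
  ⟨ a Q.* a' Q.+ (+ 3 / 1) Q.* (b Q.* b') Q.+ (+ 13 / 1) Q.* (c Q.* c') Q.+ (+ 39 / 1) Q.* (d Q.* d')
  , a Q.* b' Q.+ b Q.* a' Q.+ (+ 13 / 1) Q.* (c Q.* d' Q.+ d Q.* c')
  , a Q.* c' Q.+ c Q.* a' Q.+ (+ 3 / 1) Q.* (b Q.* d' Q.+ d Q.* b')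
  , a Q.* d' Q.+ d Q.* a' Q.+ b Q.* c' Q.+ c Q.* b' ⟩

ofℚ : ℚ → K
ofℚ q = ⟨ q , 0ℚ , 0ℚ , 0ℚ ⟩

0K 1K : K
0K = ofℚ 0ℚ
1K = ofℚ 1ℚ

√3 √13 : K
√3  = ⟨ 0ℚ , 1ℚ , 0ℚ , 0ℚ ⟩
√13 = ⟨ 0ℚ , 0ℚ , 1ℚ , 0ℚ ⟩

-- 1/√13 = √13/13
inv√13 : K
inv√13 = ⟨ 0ℚ , 0ℚ , + 1 / 13 , 0ℚ ⟩

half : K
half = ofℚ (+ 1 / 2)

nat : ℕ → K
nat n = ofℚ (+ n / 1)

_^K_ : K → ℕ → K
x ^K zero = 1K
x ^K suc k = (x ^K k) *K x

lam lamBar : K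
lam    = half *K (nat 3 +K √13)
lamBar = half *K (nat 3 -K √13)

c : ℕ → K
c k = inv√13 *K ((lam ^K suc k) -K (lamBar ^K suc k))

d : ℕ → K
d k = inv√13 *K ((half *K (nat 7 -K √13)) *K (lam ^K suc k)
                 -K (half *K (nat 7 +K √13)) *K (lamBar ^K suc k))

record Mat2 : Set where
  constructor mat
  field
    m11 m12 m21 m22 : K
open Mat2 public

_*M_ : Mat2 → Mat2 → Mat2
mat a b c' d' *M mat e f g h =
  mat (a *K e +K b *K g) (a *K f +K b *K h)
      (c' *K e +K d' *K g) (c' *K f +K d' *K h)

I₂ : Mat2
I₂ = mat 1K 0K 0K 1K

_^M_ : Mat2 → ℕ → Mat2
A ^M zero = I₂
A ^M suc k = (A ^M k) *M A

N₂ N₃ N₄ : Mat2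
N₂ = mat (nat 2) √3 √3 (nat 1)
N₃ = mat (nat 2) √3 √3 (nat 2)
N₄ = mat (nat 1) √3 √3 (nat 2)

module Submission where

-- Write the pair (c_k, d_k) as the orbit of a linear map:
-- with  next(x, y) = (5x − y, 9x − 2y)  one has  (c_{k+1}, d_{k+1}) = next(c_k, d_k)
-- and (c_0, d_0) = (1, 2).  The recurrence follows from the Binet form of c, d,
-- because λ and λ̄ are the roots of t² − 3t − 1, the characteristic polynomial
-- of next.  All three claims are then inductions along this orbit:
--   * the matrix shapes in the statement are invariant: N₂·P(x,y) = P(next(x,y))
--     and Q(x,y)·N₄ = Q(next(x,y)), where P, Q are the displayed matrix shapes,
--     and P(1,2) = Q(1,2) = N₃;
--   * the form F(x,y) = 9x² − 7xy + y² satisfies F∘next = −F (det next = −1).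

open import Defs
open import Data.Nat using (ℕ; zero; suc)
open import Data.Integer using (+_)
open import Data.Rational using (_/_; 0ℚ; 1ℚ)
import Data.Rational.Properties as ℚ
open import Data.Product using (_×_; _,_)
open import Relation.Nullary using (yes; no)
open import Relation.Binary.Definitions using (Decidable)
open import Relation.Binary.PropositionalEquality
open import Algebra.Structures {A = K} _≡_ using (IsCommutativeRing)
open import Algebra.Bundles using (CommutativeRing)
import Algebra.Solver.Ring.Simple as RingSolver
import Algebra.Solver.Ring.AlmostCommutativeRing as ACR

K-ext : ∀ {x y : K} → r x ≡ r y → s3 x ≡ s3 y → s13 x ≡ s13 y → s39 x ≡ s39 y → x ≡ y
K-ext refl refl refl refl = refl

+K-assoc : ∀ x y z → (x +K y) +K z ≡ x +K (y +K z)
+K-assoc x y z = K-ext (ℚ.+-assoc (r x) (r y) (r z)) (ℚ.+-assoc (s3 x) (s3 y) (s3 z))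
                       (ℚ.+-assoc (s13 x) (s13 y) (s13 z)) (ℚ.+-assoc (s39 x) (s39 y) (s39 z))

+K-comm : ∀ x y → x +K y ≡ y +K x
+K-comm x y = K-ext (ℚ.+-comm (r x) (r y)) (ℚ.+-comm (s3 x) (s3 y))
                    (ℚ.+-comm (s13 x) (s13 y)) (ℚ.+-comm (s39 x) (s39 y))

+K-identityˡ : ∀ x → 0K +K x ≡ x
+K-identityˡ x = K-ext (ℚ.+-identityˡ (r x)) (ℚ.+-identityˡ (s3 x))
                       (ℚ.+-identityˡ (s13 x)) (ℚ.+-identityˡ (s39 x))

-K-inverseˡ : ∀ x → (-K x) +K x ≡ 0K
-K-inverseˡ x = K-ext (ℚ.+-inverseˡ (r x)) (ℚ.+-inverseˡ (s3 x))
                      (ℚ.+-inverseˡ (s13 x)) (ℚ.+-inverseˡ (s39 x))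

-- The multiplicative laws are polynomial identities in the coordinates; the
-- multiplication table of K is mirrored on ℚ-polynomials so that each
-- coordinate of a law becomes one call of the ℚ ring solver.
module MultiplicativeLaws where
  open import Data.Rational.Solver
  open +-*-Solver

  record KPoly (n : ℕ) : Set where
    constructor ⟪_,_,_,_⟫
    field
      p₁ p₂ p₃ p₄ : Polynomial n
  open KPoly

  infixl 6 _⊕_
  infixl 7 _⊗_

  _⊕_ : ∀ {n} → KPoly n → KPoly n → KPoly n
  ⟪ a , b , c , d ⟫ ⊕ ⟪ a' , b' , c' , d' ⟫ = ⟪ a :+ a' , b :+ b' , c :+ c' , d :+ d' ⟫

  _⊗_ : ∀ {n} → KPoly n → KPoly n → KPoly n
  ⟪ a , b , c , d ⟫ ⊗ ⟪ a' , b' , c' , d' ⟫ =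
    ⟪ a :* a' :+ con (+ 3 / 1) :* (b :* b') :+ con (+ 13 / 1) :* (c :* c') :+ con (+ 39 / 1) :* (d :* d')
    , a :* b' :+ b :* a' :+ con (+ 13 / 1) :* (c :* d' :+ d :* c')
    , a :* c' :+ c :* a' :+ con (+ 3 / 1) :* (b :* d' :+ d :* b')
    , a :* d' :+ d :* a' :+ b :* c' :+ c :* b' ⟫

  one : ∀ {n} → KPoly n
  one = ⟪ con 1ℚ , con 0ℚ , con 0ℚ , con 0ℚ ⟫

  *K-assoc : ∀ x y z → (x *K y) *K z ≡ x *K (y *K z)
  *K-assoc ⟨ a , b , c , d ⟩ ⟨ e , f , g , h ⟩ ⟨ i , j , k , l ⟩ = K-ext
    (solve 12 (λ a b c d e f g h i j k l → p₁ ((⟪ a , b , c , d ⟫ ⊗ ⟪ e , f , g , h ⟫) ⊗ ⟪ i , j , k , l ⟫) := p₁ (⟪ a , b , c , d ⟫ ⊗ (⟪ e , f , g , h ⟫ ⊗ ⟪ i , j , k , l ⟫))) refl a b c d e f g h i j k l)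
    (solve 12 (λ a b c d e f g h i j k l → p₂ ((⟪ a , b , c , d ⟫ ⊗ ⟪ e , f , g , h ⟫) ⊗ ⟪ i , j , k , l ⟫) := p₂ (⟪ a , b , c , d ⟫ ⊗ (⟪ e , f , g , h ⟫ ⊗ ⟪ i , j , k , l ⟫))) refl a b c d e f g h i j k l)
    (solve 12 (λ a b c d e f g h i j k l → p₃ ((⟪ a , b , c , d ⟫ ⊗ ⟪ e , f , g , h ⟫) ⊗ ⟪ i , j , k , l ⟫) := p₃ (⟪ a , b , c , d ⟫ ⊗ (⟪ e , f , g , h ⟫ ⊗ ⟪ i , j , k , l ⟫))) refl a b c d e f g h i j k l)
    (solve 12 (λ a b c d e f g h i j k l → p₄ ((⟪ a , b , c , d ⟫ ⊗ ⟪ e , f , g , h ⟫) ⊗ ⟪ i , j , k , l ⟫) := p₄ (⟪ a , b , c , d ⟫ ⊗ (⟪ e , f , g , h ⟫ ⊗ ⟪ i , j , k , l ⟫))) refl a b c d e f g h i j k l)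

  *K-comm : ∀ x y → x *K y ≡ y *K x
  *K-comm ⟨ a , b , c , d ⟩ ⟨ e , f , g , h ⟩ = K-ext
    (solve 8 (λ a b c d e f g h → p₁ (⟪ a , b , c , d ⟫ ⊗ ⟪ e , f , g , h ⟫) := p₁ (⟪ e , f , g , h ⟫ ⊗ ⟪ a , b , c , d ⟫)) refl a b c d e f g h)
    (solve 8 (λ a b c d e f g h → p₂ (⟪ a , b , c , d ⟫ ⊗ ⟪ e , f , g , h ⟫) := p₂ (⟪ e , f , g , h ⟫ ⊗ ⟪ a , b , c , d ⟫)) refl a b c d e f g h)
    (solve 8 (λ a b c d e f g h → p₃ (⟪ a , b , c , d ⟫ ⊗ ⟪ e , f , g , h ⟫) := p₃ (⟪ e , f , g , h ⟫ ⊗ ⟪ a , b , c , d ⟫)) refl a b c d e f g h)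
    (solve 8 (λ a b c d e f g h → p₄ (⟪ a , b , c , d ⟫ ⊗ ⟪ e , f , g , h ⟫) := p₄ (⟪ e , f , g , h ⟫ ⊗ ⟪ a , b , c , d ⟫)) refl a b c d e f g h)

  *K-identityˡ : ∀ x → 1K *K x ≡ x
  *K-identityˡ ⟨ a , b , c , d ⟩ = K-ext
    (solve 4 (λ a b c d → p₁ (one ⊗ ⟪ a , b , c , d ⟫) := a) refl a b c d)
    (solve 4 (λ a b c d → p₂ (one ⊗ ⟪ a , b , c , d ⟫) := b) refl a b c d)
    (solve 4 (λ a b c d → p₃ (one ⊗ ⟪ a , b , c , d ⟫) := c) refl a b c d)
    (solve 4 (λ a b c d → p₄ (one ⊗ ⟪ a , b , c , d ⟫) := d) refl a b c d)

  *K-distribˡ : ∀ x y z → x *K (y +K z) ≡ (x *K y) +K (x *K z)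
  *K-distribˡ ⟨ a , b , c , d ⟩ ⟨ e , f , g , h ⟩ ⟨ i , j , k , l ⟩ = K-ext
    (solve 12 (λ a b c d e f g h i j k l → p₁ (⟪ a , b , c , d ⟫ ⊗ (⟪ e , f , g , h ⟫ ⊕ ⟪ i , j , k , l ⟫)) := p₁ (⟪ a , b , c , d ⟫ ⊗ ⟪ e , f , g , h ⟫ ⊕ ⟪ a , b , c , d ⟫ ⊗ ⟪ i , j , k , l ⟫)) refl a b c d e f g h i j k l)
    (solve 12 (λ a b c d e f g h i j k l → p₂ (⟪ a , b , c , d ⟫ ⊗ (⟪ e , f , g , h ⟫ ⊕ ⟪ i , j , k , l ⟫)) := p₂ (⟪ a , b , c , d ⟫ ⊗ ⟪ e , f , g , h ⟫ ⊕ ⟪ a , b , c , d ⟫ ⊗ ⟪ i , j , k , l ⟫)) refl a b c d e f g h i j k l)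
    (solve 12 (λ a b c d e f g h i j k l → p₃ (⟪ a , b , c , d ⟫ ⊗ (⟪ e , f , g , h ⟫ ⊕ ⟪ i , j , k , l ⟫)) := p₃ (⟪ a , b , c , d ⟫ ⊗ ⟪ e , f , g , h ⟫ ⊕ ⟪ a , b , c , d ⟫ ⊗ ⟪ i , j , k , l ⟫)) refl a b c d e f g h i j k l)
    (solve 12 (λ a b c d e f g h i j k l → p₄ (⟪ a , b , c , d ⟫ ⊗ (⟪ e , f , g , h ⟫ ⊕ ⟪ i , j , k , l ⟫)) := p₄ (⟪ a , b , c , d ⟫ ⊗ ⟪ e , f , g , h ⟫ ⊕ ⟪ a , b , c , d ⟫ ⊗ ⟪ i , j , k , l ⟫)) refl a b c d e f g h i j k l)

open MultiplicativeLaws using (*K-assoc; *K-comm; *K-identityˡ; *K-distribˡ)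

K-isCommutativeRing : IsCommutativeRing _+K_ _*K_ (λ x → -K x) 0K 1K
K-isCommutativeRing = record
  { isRing = record
    { +-isAbelianGroup = record
      { isGroup = record
        { isMonoid = record
          { isSemigroup = record
            { isMagma = record { isEquivalence = isEquivalence ; ∙-cong = cong₂ _+K_ }
            ; assoc = +K-assoc }
          ; identity = +K-identityˡ , λ x → trans (+K-comm x 0K) (+K-identityˡ x) }
        ; inverse = -K-inverseˡ , λ x → trans (+K-comm x (-K x)) (-K-inverseˡ x)
        ; ⁻¹-cong = cong (λ x → -K x) }
      ; comm = +K-comm }
    ; *-cong = cong₂ _*K_
    ; *-assoc = *K-assoc
    ; *-identity = *K-identityˡ , λ x → trans (*K-comm x 1K) (*K-identityˡ x)
    ; distrib = *K-distribˡ , λ x y z → trans (*K-comm (y +K z) x)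
                  (trans (*K-distribˡ x y z) (cong₂ _+K_ (*K-comm x y) (*K-comm x z))) }
  ; *-comm = *K-comm }

K-commutativeRing : CommutativeRing _ _
K-commutativeRing = record { isCommutativeRing = K-isCommutativeRing }

-- Decidable equality lets the solver evaluate constants of K such as λ and √3.
_≟K_ : Decidable {A = K} _≡_
⟨ a , b , c , d ⟩ ≟K ⟨ a' , b' , c' , d' ⟩
  with a ℚ.≟ a' | b ℚ.≟ b' | c ℚ.≟ c' | d ℚ.≟ d'
... | yes refl | yes refl | yes refl | yes refl = yes refl
... | no a≢a'  | _        | _        | _        = no λ { refl → a≢a' refl }
... | yes _    | no b≢b'  | _        | _        = no λ { refl → b≢b' refl }
... | yes _    | yes _    | no c≢c'  | _        = no λ { refl → c≢c' refl }
... | yes _    | yes _    | yes _    | no d≢d'  = no λ { refl → d≢d' refl }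

open RingSolver (ACR.fromCommutativeRing K-commutativeRing) _≟K_
  using (solve; _:+_; _:*_; _:-_; :-_; _:=_; con)

mat-ext : ∀ {a b c' d' e f g h} → a ≡ e → b ≡ f → c' ≡ g → d' ≡ h → mat a b c' d' ≡ mat e f g h
mat-ext refl refl refl refl = refl

*M-assoc : ∀ A B C → (A *M B) *M C ≡ A *M (B *M C)
*M-assoc (mat a b c' d') (mat e f g h) (mat i j k l) =
  mat-ext (entry a b i k) (entry a b j l) (entry c' d' i k) (entry c' d' j l)
  where
  entry : ∀ a b i k → (a *K e +K b *K g) *K i +K (a *K f +K b *K h) *K k
                    ≡ a *K (e *K i +K f *K k) +K b *K (g *K i +K h *K k)
  entry = solve 8 (λ e f g h a b i k → (a :* e :+ b :* g) :* i :+ (a :* f :+ b :* h) :* k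
                                    := a :* (e :* i :+ f :* k) :+ b :* (g :* i :+ h :* k)) refl e f g h

*M-identityˡ : ∀ A → I₂ *M A ≡ A
*M-identityˡ (mat a b c' d') = mat-ext (entry a c') (entry b d') (entry' a c') (entry' b d')
  where
  entry  : ∀ x y → 1K *K x +K 0K *K y ≡ x
  entry' : ∀ x y → 0K *K x +K 1K *K y ≡ y
  entry  = solve 2 (λ x y → con 1K :* x :+ con 0K :* y := x) refl
  entry' = solve 2 (λ x y → con 0K :* x :+ con 1K :* y := y) refl

*M-identityʳ : ∀ A → A *M I₂ ≡ A
*M-identityʳ (mat a b c' d') = mat-ext (entry a b) (entry' a b) (entry c' d') (entry' c' d')
  where
  entry  : ∀ x y → x *K 1K +K y *K 0K ≡ x
  entry' : ∀ x y → x *K 0K +K y *K 1K ≡ y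
  entry  = solve 2 (λ x y → x :* con 1K :+ y :* con 0K := x) refl
  entry' = solve 2 (λ x y → x :* con 0K :+ y :* con 1K := y) refl

-- A power of A commutes with A; needed to peel factors off the left of A^(k+1).
^M-comm : ∀ A k → (A ^M k) *M A ≡ A *M (A ^M k)
^M-comm A zero    = trans (*M-identityˡ A) (sym (*M-identityʳ A))
^M-comm A (suc k) = trans (cong (_*M A) (^M-comm A k)) (*M-assoc A (A ^M k) A)

left-orbit : ∀ A (M : ℕ → Mat2) → (∀ k → A *M M k ≡ M (suc k)) → ∀ k → (A ^M k) *M M 0 ≡ M k
left-orbit A M step zero    = *M-identityˡ (M 0)
left-orbit A M step (suc k) = begin
  ((A ^M k) *M A) *M M 0   ≡⟨ cong (_*M M 0) (^M-comm A k) ⟩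
  (A *M (A ^M k)) *M M 0   ≡⟨ *M-assoc A (A ^M k) (M 0) ⟩
  A *M ((A ^M k) *M M 0)   ≡⟨ cong (A *M_) (left-orbit A M step k) ⟩
  A *M M k                 ≡⟨ step k ⟩
  M (suc k)                ∎
  where open ≡-Reasoning

right-orbit : ∀ A (M : ℕ → Mat2) → (∀ k → M k *M A ≡ M (suc k)) → ∀ k → M 0 *M (A ^M k) ≡ M k
right-orbit A M step zero    = *M-identityʳ (M 0)
right-orbit A M step (suc k) = begin
  M 0 *M ((A ^M k) *M A)   ≡⟨ sym (*M-assoc (M 0) (A ^M k) A) ⟩
  (M 0 *M (A ^M k)) *M A   ≡⟨ cong (_*M A) (right-orbit A M step k) ⟩
  M k *M A                 ≡⟨ step k ⟩
  M (suc k)                ∎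
  where open ≡-Reasoning

nextC nextD : K → K → K
nextC x y = nat 5 *K x -K y
nextD x y = nat 9 *K x -K nat 2 *K y

α β : K
α = half *K (nat 7 -K √13)
β = half *K (nat 7 +K √13)

-- Binet recurrence: multiplying λ^(k+1) by λ and λ̄^(k+1) by λ̄ realises the step.
c-suc : ∀ k → c (suc k) ≡ nextC (c k) (d k)
c-suc k = solve 2 (λ L M → con inv√13 :* (L :* con lam :- M :* con lamBar)
                        := con (nat 5) :* (con inv√13 :* (L :- M))
                           :- con inv√13 :* (con α :* L :- con β :* M)) refl (lam ^K suc k) (lamBar ^K suc k)

d-suc : ∀ k → d (suc k) ≡ nextD (c k) (d k)
d-suc k = solve 2 (λ L M → con inv√13 :* (con α :* (L :* con lam) :- con β :* (M :* con lamBar))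
                        := con (nat 9) :* (con inv√13 :* (L :- M))
                           :- con (nat 2) :* (con inv√13 :* (con α :* L :- con β :* M))) refl (lam ^K suc k) (lamBar ^K suc k)

-- The two matrix shapes of the statement; at (x, y) = (c₀, d₀) = (1, 2) both are N₃.
leftShape rightShape : K → K → Mat2
leftShape  x y = mat (nat 4 *K x -K y) (√3 *K (nat 3 *K x -K y)) (√3 *K x) y
rightShape x y = mat y (√3 *K (nat 3 *K x -K y)) (√3 *K x) (nat 4 *K x -K y)

N₂-leftShape : ∀ x y → N₂ *M leftShape x y ≡ leftShape (nextC x y) (nextD x y)
N₂-leftShape x y = mat-ext
  (solve 2 (λ x y → con (nat 2) :* (con (nat 4) :* x :- y) :+ con √3 :* (con √3 :* x) := con (nat 4) :* (con (nat 5) :* x :- y) :- (con (nat 9) :* x :- con (nat 2) :* y)) refl x y)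
  (solve 2 (λ x y → con (nat 2) :* (con √3 :* (con (nat 3) :* x :- y)) :+ con √3 :* y := con √3 :* (con (nat 3) :* (con (nat 5) :* x :- y) :- (con (nat 9) :* x :- con (nat 2) :* y))) refl x y)
  (solve 2 (λ x y → con √3 :* (con (nat 4) :* x :- y) :+ con (nat 1) :* (con √3 :* x) := con √3 :* (con (nat 5) :* x :- y)) refl x y)
  (solve 2 (λ x y → con √3 :* (con √3 :* (con (nat 3) :* x :- y)) :+ con (nat 1) :* y := con (nat 9) :* x :- con (nat 2) :* y) refl x y)

rightShape-N₄ : ∀ x y → rightShape x y *M N₄ ≡ rightShape (nextC x y) (nextD x y)
rightShape-N₄ x y = mat-ext
  (solve 2 (λ x y → y :* con (nat 1) :+ con √3 :* (con (nat 3) :* x :- y) :* con √3 := con (nat 9) :* x :- con (nat 2) :* y) refl x y)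
  (solve 2 (λ x y → y :* con √3 :+ con √3 :* (con (nat 3) :* x :- y) :* con (nat 2) := con √3 :* (con (nat 3) :* (con (nat 5) :* x :- y) :- (con (nat 9) :* x :- con (nat 2) :* y))) refl x y)
  (solve 2 (λ x y → con √3 :* x :* con (nat 1) :+ (con (nat 4) :* x :- y) :* con √3 := con √3 :* (con (nat 5) :* x :- y)) refl x y)
  (solve 2 (λ x y → con √3 :* x :* con √3 :+ (con (nat 4) :* x :- y) :* con (nat 2) := con (nat 4) :* (con (nat 5) :* x :- y) :- (con (nat 9) :* x :- con (nat 2) :* y)) refl x y)

F : K → K → K
F x y = nat 9 *K (x *K x) -K nat 7 *K (x *K y) +K y *K y

-- F changes sign under the step, which has determinant −1.
F-next : ∀ x y → F (nextC x y) (nextD x y) ≡ F x y *K (-K 1K)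
F-next = solve 2 (λ x y →
    con (nat 9) :* ((con (nat 5) :* x :- y) :* (con (nat 5) :* x :- y))
    :- con (nat 7) :* ((con (nat 5) :* x :- y) :* (con (nat 9) :* x :- con (nat 2) :* y))
    :+ (con (nat 9) :* x :- con (nat 2) :* y) :* (con (nat 9) :* x :- con (nat 2) :* y)
  := (con (nat 9) :* (x :* x) :- con (nat 7) :* (x :* y) :+ y :* y) :* (:- con 1K)) refl

-- F(c_k, d_k) = (−1)^(k+1), since F(c₀, d₀) = F(1, 2) = −1.
F-orbit : ∀ k → F (c k) (d k) ≡ (-K 1K) ^K suc k
F-orbit zero    = refl
F-orbit (suc k) = begin
  F (c (suc k)) (d (suc k))                 ≡⟨ cong₂ F (c-suc k) (d-suc k) ⟩
  F (nextC (c k) (d k)) (nextD (c k) (d k)) ≡⟨ F-next (c k) (d k) ⟩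
  F (c k) (d k) *K (-K 1K)                  ≡⟨ cong (_*K (-K 1K)) (F-orbit k) ⟩
  (-K 1K) ^K suc (suc k)                    ∎
  where open ≡-Reasoning

proposition4p14 : (k : ℕ) →
    ((N₂ ^M k) *M N₃ ≡ mat (nat 4 *K c k -K d k) (√3 *K (nat 3 *K c k -K d k)) (√3 *K c k) (d k))
    × (N₃ *M (N₄ ^M k) ≡ mat (d k) (√3 *K (nat 3 *K c k -K d k)) (√3 *K c k) (nat 4 *K c k -K d k))
    × (nat 9 *K (c k *K c k) -K nat 7 *K (c k *K d k) +K d k *K d k ≡ (-K 1K) ^K suc k)
proposition4p14 k =
  left-orbit N₂ (λ j → leftShape (c j) (d j)) leftStep k ,
  right-orbit N₄ (λ j → rightShape (c j) (d j)) rightStep k ,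
  F-orbit k
  where
  -- N₃ = leftShape(c₀, d₀) = rightShape(c₀, d₀) holds by computation,
  -- and one step of the orbit is the shape invariance plus the recurrence.
  leftStep : ∀ j → N₂ *M leftShape (c j) (d j) ≡ leftShape (c (suc j)) (d (suc j))
  leftStep j = trans (N₂-leftShape (c j) (d j)) (sym (cong₂ leftShape (c-suc j) (d-suc j)))

  rightStep : ∀ j → rightShape (c j) (d j) *M N₄ ≡ rightShape (c (suc j)) (d (suc j))
  rightStep j = trans (rightShape-N₄ (c j) (d j)) (sym (cong₂ rightShape (c-suc j) (d-suc j)))
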